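{- Let $\ell\ge 2$ and $k\ge 1$. Let $\Upsilon_\ell^k$ be the map deleting the first column of a partition diagram. Then $\Upsilon_\ell^k$ is a bijection from the set of partitions $\nu$ with $\nu_1\le \ell-1$ and $len(\nu)=k$ onto the set of partitions $\sigma$ with $\sigma_1\le\ell-2$ and $len(\sigma)\le k$, and for every $\ell$-core $\lambda$ with $len(\lambda)=k$ we have \[ \rho_{\ell-1}\big(\widetilde{\Phi_\ell^k}(\lambda)\big)=\Upsilon_\ell^k\big(\rho_\ell(\lambda)\big). \]
   Context: Partitions are in English notation; $len(\lambda)$ is the number of nonzero parts; $h^\lambda_{(x,y)}$ is the hook length of box $(x,y)$ (number of boxes weakly right of it in its row or weakly below it in its column). An $m$-core is a partition none of whose hook lengths is divisible by $m$. For an $m$-core $\mu$, $\rho_m(\mu)$ (the Lapointe–Morse correspondence) is the partition whose $r$-th part is the number of boxes in row $r$ of $\mu$ with hook length less than $m$ (i.e. left-justify the rows of $\mu/\gamma$, where $\gamma$ is the set of boxes of hook length $>m$); it has first part $\le m-1$ and the same length as $\mu$. For an $\ell$-core $\lambda$ with $len(\lambda)=k$, $\widetilde{\Phi_\ell^k}(\lambda)$ is the partition obtained by deleting from the diagram of $\lambda$ every column $j$ with $h^\lambda_{(1,j)}\equiv h^\lambda_{(1,1)}\pmod\ell$ (equivalently, the transpose of the partition obtained from the transpose of $\lambda$ by deleting the rows whose first-column hook length is congruent to that of the first row mod $\ell$); it is an $(\ell-1)$-core of length at most $k$. -}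

module Defs where

open import Data.Nat using (ℕ; zero; suc; _+_; _∸_; _≤_; _<_; _≥_; _≤ᵇ_; _<ᵇ_)
open import Data.Nat.Divisibility using (_∣_; _∣?_)
open import Data.Bool using (Bool; true; false; if_then_else_; not)
open import Data.List using (List; []; _∷_; length; map)
open import Data.List.Relation.Unary.All using (All)
open import Data.List.Relation.Unary.Linked using (Linked)
open import Data.Product using (_×_)
open import Relation.Nullary using (¬_; does)
open import Relation.Binary.PropositionalEquality using (_≡_)

IsPartition : List ℕ → Set
IsPartition λ′ = All (λ a → 1 ≤ a) λ′ × Linked _≥_ λ′

head0 : List ℕ → ℕ
head0 [] = 0
head0 (a ∷ _) = a

-- part i (1-indexed), 0 outside
part : List ℕ → ℕ → ℕ
part [] _ = 0
part (a ∷ _) zero = 0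
part (a ∷ _) (suc zero) = a
part (_ ∷ as) (suc (suc i)) = part as (suc i)

conj : List ℕ → ℕ → ℕ
conj [] j = 0
conj (a ∷ as) j = if j ≤ᵇ a then suc (conj as j) else conj as j

hook : List ℕ → ℕ → ℕ → ℕ
hook λ′ x y = (part λ′ x + conj λ′ y + 1) ∸ (x + y)

IsBox : List ℕ → ℕ → ℕ → Set
IsBox λ′ x y = 1 ≤ x × x ≤ length λ′ × 1 ≤ y × y ≤ part λ′ x

IsCore : ℕ → List ℕ → Set
IsCore m λ′ = ∀ x y → IsBox λ′ x y → ¬ (m ∣ hook λ′ x y)

countUpTo : (ℕ → Bool) → ℕ → ℕ
countUpTo p zero = 0
countUpTo p (suc n) = if p (suc n) then suc (countUpTo p n) else countUpTo p n

rowsFrom : (ℕ → ℕ → ℕ) → ℕ → List ℕ → List ℕ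
rowsFrom f i [] = []
rowsFrom f i (a ∷ as) = f i a ∷ rowsFrom f (suc i) as

dropZeros : List ℕ → List ℕ
dropZeros [] = []
dropZeros (zero ∷ as) = dropZeros as
dropZeros (suc a ∷ as) = suc a ∷ dropZeros as

ρ : ℕ → List ℕ → List ℕ
ρ m μ = rowsFrom (λ r a → countUpTo (λ y → hook μ r y <ᵇ m) a) 1 μ

congMod : ℕ → ℕ → ℕ → Bool
congMod ℓ a b = does (ℓ ∣? ((a ∸ b) + (b ∸ a)))

-- Φ̃_ℓ^k: delete every column j with h_(1,j) ≡ h_(1,1) (mod ℓ); row i keeps its
-- columns j ≤ λ_i not deleted; empty rows are removed.
Φ̃ : ℕ → List ℕ → List ℕ
Φ̃ ℓ λ′ = dropZeros (rowsFrom (λ i a → countUpTo (λ j → not (congMod ℓ (hook λ′ 1 j) (hook λ′ 1 1))) a) 1 λ′)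

Υ : List ℕ → List ℕ
Υ ν = dropZeros (map (λ a → a ∸ 1) ν)

InA : ℕ → ℕ → List ℕ → Set
InA ℓ k ν = IsPartition ν × head0 ν ≤ ℓ ∸ 1 × length ν ≡ k

InB : ℕ → ℕ → List ℕ → Set
InB ℓ k σ = IsPartition σ × head0 σ ≤ ℓ ∸ 2 × length σ ≤ k

-- Υ is inverted by prolonging every row by one box and padding with rows of
-- length one up to k rows.
--
-- For the identity, fix a row r of the ℓ-core λ with hooks H 1 > H 2 > ⋯ .
-- Every value below H j is either a hook further right in row r or H j minus
-- a hook below (r, j); as ℓ is not a hook, each H j > ℓ has H j − ℓ further
-- right, so reducing along the row modulo ℓ always ends below ℓ. Hooks in a
-- common column differ by a row-dependent constant, so Φ̃ deletes exactly the
-- columns j with H j ≡ H 1 (mod ℓ), and exactly one of them has H j < ℓ.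
-- Deleting columns shortens the arm of a surviving box by the number of deleted
-- columns to its right; since two deleted columns have hooks at least ℓ apart,
-- a surviving box has hook < ℓ in λ iff its image has hook < ℓ − 1 in Φ̃ λ.
-- Hence each row of ρ_{ℓ−1}(Φ̃ λ) is the matching row of ρ_ℓ(λ) minus one.

module Submission where

open import Defs
open import Data.Bool using (Bool; true; false; not; _∧_)
open import Data.Bool.Properties using (T-≡; not-injective; not-¬)
open import Data.Empty using (⊥; ⊥-elim)
open import Data.List using (List; []; _∷_; _++_; length; map; replicate)
open import Data.List.Properties using (length-map; length-++; length-replicate)
open import Data.List.Relation.Unary.All using (All; []; _∷_)
import Data.List.Relation.Unary.All as All
open import Data.List.Relation.Unary.All.Properties using (++⁺; replicate⁺)
import Data.List.Relation.Unary.All.Properties as Allₚ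
open import Data.List.Relation.Unary.Linked using (Linked; []; [-]; _∷_; tail)
import Data.List.Relation.Unary.Linked as Linked
open import Data.List.Relation.Unary.Linked.Properties using (map⁺)
open import Data.Nat using (ℕ; zero; suc; _+_; _*_; _∸_; _/_; _%_; _≤_; _<_; _≥_; _≤ᵇ_; _<ᵇ_; _≤?_; _<?_; z≤n; s≤s; s≤s⁻¹; z<s; NonZero; >-nonZero; >-nonZero⁻¹)
open import Data.Nat.DivMod using (%-remove-+ʳ; m≡m%n+[m/n]*n; [m+n]%n≡m%n; m<n⇒m%n≡m)
open import Data.Nat.Divisibility using (_∣_; _∣?_; divides; ∣⇒≤; ∣-reflexive)
open import Data.Nat.Properties
open import Algebra.Properties.CommutativeSemigroup +-commutativeSemigroup using () renaming (interchange to +-interchange)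
open import Data.Nat.Tactic.RingSolver using (solve-∀)
open import Data.Product using (Σ; _×_; _,_)
open import Data.Sum using (_⊎_; inj₁; inj₂)
import Data.Sum as Sum
open import Function.Base using (_∘_; case_of_)
open import Function.Bundles using (Equivalence; _⇔_; mk⇔)
open import Function.Properties.Equivalence using () renaming (trans to ⇔-trans)
open import Relation.Binary using (tri<; tri≈; tri>)
open import Relation.Binary.PropositionalEquality
open import Relation.Nullary using (Dec; does; yes; no)

-- Counting

indicator : Bool → ℕ
indicator true = 1
indicator false = 0

indicator-split : ∀ k s t → (k ≡ true → s ≡ t) → indicator s ≡ indicator (k ∧ t) + indicator (not k ∧ s)
indicator-split false s t _ = refl
indicator-split true s t s≡t rewrite s≡t refl = sym (+-identityʳ (indicator t))

∧≡true⇒ : ∀ {x y} → x ∧ y ≡ true → x ≡ true × y ≡ true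
∧≡true⇒ {true} {true} _ = refl , refl

countUpTo-suc : ∀ p n → countUpTo p (suc n) ≡ indicator (p (suc n)) + countUpTo p n
countUpTo-suc p n with p (suc n)
... | true = refl
... | false = refl

countUpTo-mono : ∀ p {m n} → m ≤ n → countUpTo p m ≤ countUpTo p n
countUpTo-mono p {n = zero} z≤n = ≤-refl
countUpTo-mono p {m} {suc n} m≤1+n with m≤n⇒m<n∨m≡n m≤1+n
... | inj₂ refl = ≤-refl
... | inj₁ (s≤s m≤n) rewrite countUpTo-suc p n =
  ≤-trans (countUpTo-mono p m≤n) (m≤n+m (countUpTo p n) (indicator (p (suc n))))

countUpTo-strict : ∀ p {m n} → m ≤ n → p (suc n) ≡ true → countUpTo p m < countUpTo p (suc n)
countUpTo-strict p {n = n} m≤n pn rewrite countUpTo-suc p n | pn = s≤s (countUpTo-mono p m≤n)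

countUpTo-≤-+∸ : ∀ p {m n} → m ≤ n → countUpTo p n ≤ countUpTo p m + (n ∸ m)
countUpTo-≤-+∸ p {m} {zero} z≤n = m≤m+n (countUpTo p 0) 0
countUpTo-≤-+∸ p {m} {suc n} m≤1+n with m≤n⇒m<n∨m≡n m≤1+n
... | inj₂ refl = m≤m+n _ _
... | inj₁ (s≤s m≤n) = begin
  countUpTo p (suc n)                       ≡⟨ countUpTo-suc p n ⟩
  indicator (p (suc n)) + countUpTo p n     ≤⟨ +-mono-≤ (indicator≤1 (p (suc n))) (countUpTo-≤-+∸ p m≤n) ⟩
  1 + (countUpTo p m + (n ∸ m))             ≡⟨ +-suc (countUpTo p m) (n ∸ m) ⟨
  countUpTo p m + suc (n ∸ m)               ≡⟨ cong (countUpTo p m +_) (+-∸-assoc 1 m≤n) ⟨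
  countUpTo p m + (suc n ∸ m)               ∎
  where
  open ≤-Reasoning
  indicator≤1 : ∀ b → indicator b ≤ 1
  indicator≤1 true = ≤-refl
  indicator≤1 false = z≤n

countUpTo-complement : ∀ p n → countUpTo p n + countUpTo (λ j → not (p j)) n ≡ n
countUpTo-complement p zero = refl
countUpTo-complement p (suc n) with p (suc n)
... | true = cong suc (countUpTo-complement p n)
... | false = trans (+-suc _ _) (cong suc (countUpTo-complement p n))

countUpTo-split : ∀ P Q R n →
  (∀ j → 1 ≤ j → j ≤ n → indicator (P j) ≡ indicator (Q j) + indicator (R j)) →
  countUpTo P n ≡ countUpTo Q n + countUpTo R n
countUpTo-split P Q R zero _ = refl
countUpTo-split P Q R (suc n) P≡Q+R = begin
  countUpTo P (suc n)                                             ≡⟨ countUpTo-suc P n ⟩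
  indicator (P (suc n)) + countUpTo P n                           ≡⟨ cong₂ _+_ (P≡Q+R (suc n) (s≤s z≤n) ≤-refl)
                                                                      (countUpTo-split P Q R n (λ j 1≤j j≤n → P≡Q+R j 1≤j (m≤n⇒m≤1+n j≤n))) ⟩
  (indicator (Q (suc n)) + indicator (R (suc n))) + (countUpTo Q n + countUpTo R n)
                                                                  ≡⟨ +-interchange (indicator (Q (suc n))) (indicator (R (suc n))) (countUpTo Q n) (countUpTo R n) ⟩
  (indicator (Q (suc n)) + countUpTo Q n) + (indicator (R (suc n)) + countUpTo R n)
                                                                  ≡⟨ sym (cong₂ _+_ (countUpTo-suc Q n) (countUpTo-suc R n)) ⟩
  countUpTo Q (suc n) + countUpTo R (suc n)                       ∎
  where open ≡-Reasoning

countUpTo-reindex : ∀ p q n → countUpTo p (countUpTo q n) ≡ countUpTo (λ j → q j ∧ p (countUpTo q j)) n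
countUpTo-reindex p q zero = refl
countUpTo-reindex p q (suc n) with q (suc n)
... | false = countUpTo-reindex p q n
... | true with p (suc (countUpTo q n))
...   | true = cong suc (countUpTo-reindex p q n)
...   | false = countUpTo-reindex p q n

countUpTo-positive : ∀ p {n j} → 1 ≤ j → j ≤ n → p j ≡ true → 1 ≤ countUpTo p n
countUpTo-positive p {zero} (s≤s _) ()
countUpTo-positive p {suc n} {j} 1≤j j≤1+n pj with m≤n⇒m<n∨m≡n j≤1+n
... | inj₂ refl rewrite countUpTo-suc p n | pj = s≤s z≤n
... | inj₁ (s≤s j≤n) = ≤-trans (countUpTo-positive p 1≤j j≤n pj) (countUpTo-mono p (n≤1+n n))

countUpTo-witness : ∀ p n → 1 ≤ countUpTo p n → Σ ℕ (λ j → 1 ≤ j × j ≤ n × p j ≡ true)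
countUpTo-witness p (suc n) pos with p (suc n) in pn
... | true = suc n , s≤s z≤n , ≤-refl , pn
... | false with countUpTo-witness p n pos
...   | j , 1≤j , j≤n , pj = j , 1≤j , m≤n⇒m≤1+n j≤n , pj

countUpTo-constant : ∀ p {m n} → m ≤ n → (∀ y → m < y → y ≤ n → p y ≡ false) → countUpTo p n ≡ countUpTo p m
countUpTo-constant p {n = zero} z≤n _ = refl
countUpTo-constant p {m} {suc n} m≤1+n none with m≤n⇒m<n∨m≡n m≤1+n
... | inj₂ refl = refl
... | inj₁ (s≤s m≤n) rewrite countUpTo-suc p n | none (suc n) (s≤s m≤n) ≤-refl =
  countUpTo-constant p m≤n (λ y m<y y≤n → none y m<y (m≤n⇒m≤1+n y≤n))

countUpTo-atMostOne : ∀ p {m n} → m ≤ n →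
  (∀ y y′ → m < y → y ≤ n → m < y′ → y′ ≤ n → p y ≡ true → p y′ ≡ true → y ≡ y′) →
  countUpTo p n ≤ suc (countUpTo p m)
countUpTo-atMostOne p {n = zero} z≤n _ = n≤1+n _
countUpTo-atMostOne p {m} {suc n} m≤1+n unique with m≤n⇒m<n∨m≡n m≤1+n
... | inj₂ refl = n≤1+n _
... | inj₁ (s≤s m≤n) with p (suc n) in pn
...   | false = countUpTo-atMostOne p m≤n
                  (λ y y′ m<y y≤n m<y′ y′≤n → unique y y′ m<y (m≤n⇒m≤1+n y≤n) m<y′ (m≤n⇒m≤1+n y′≤n))
...   | true = s≤s (≤-reflexive (countUpTo-constant p m≤n none))
  where
  none : ∀ y → m < y → y ≤ n → p y ≡ false
  none y m<y y≤n with p y in py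
  ... | false = refl
  ... | true = ⊥-elim (<⇒≢ (s≤s y≤n) (unique y (suc n) m<y (m≤n⇒m≤1+n y≤n) (s≤s m≤n) ≤-refl py pn))

countUpTo-unique : ∀ p {n} j₀ → 1 ≤ j₀ → j₀ ≤ n → p j₀ ≡ true →
  (∀ j → 1 ≤ j → j ≤ n → p j ≡ true → j ≡ j₀) → countUpTo p n ≡ 1
countUpTo-unique p j₀ 1≤j₀ j₀≤n pj₀ unique = ≤-antisym
  (countUpTo-atMostOne p z≤n (λ y y′ 0<y y≤n 0<y′ y′≤n py py′ → trans (unique y 0<y y≤n py) (sym (unique y′ 0<y′ y′≤n py′))))
  (countUpTo-positive p 1≤j₀ j₀≤n pj₀)

≤⇒≤ᵇ≡true : ∀ {m n} → m ≤ n → (m ≤ᵇ n) ≡ true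
≤⇒≤ᵇ≡true m≤n = Equivalence.to T-≡ (≤⇒≤ᵇ m≤n)

>⇒≤ᵇ≡false : ∀ {m n} → n < m → (m ≤ᵇ n) ≡ false
>⇒≤ᵇ≡false {m} {n} n<m with m ≤ᵇ n in m≤ᵇn
... | false = refl
... | true = ⊥-elim (<⇒≱ n<m (≤ᵇ⇒≤ m n (Equivalence.from T-≡ m≤ᵇn)))

<⇒<ᵇ≡true : ∀ {m n} → m < n → (m <ᵇ n) ≡ true
<⇒<ᵇ≡true m<n = Equivalence.to T-≡ (<⇒<ᵇ m<n)

≥⇒<ᵇ≡false : ∀ {m n} → n ≤ m → (m <ᵇ n) ≡ false
≥⇒<ᵇ≡false {m} {n} n≤m with m <ᵇ n in m<ᵇn
... | false = refl
... | true = ⊥-elim (<⇒≱ (<ᵇ⇒< m n (Equivalence.from T-≡ m<ᵇn)) n≤m)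

<ᵇ≡true⇒< : ∀ {m n} → (m <ᵇ n) ≡ true → m < n
<ᵇ≡true⇒< {m} {n} m<ᵇn = <ᵇ⇒< m n (Equivalence.from T-≡ m<ᵇn)

does≡true⇔ : ∀ {A : Set} (a? : Dec A) → does a? ≡ true ⇔ A
does≡true⇔ (yes a) = mk⇔ (λ _ → a) (λ _ → refl)
does≡true⇔ (no ¬a) = mk⇔ (λ ()) (⊥-elim ∘ ¬a)

-- Lists of rows

conj-∷-≤ : ∀ {a j} L → j ≤ a → conj (a ∷ L) j ≡ suc (conj L j)
conj-∷-≤ L j≤a rewrite ≤⇒≤ᵇ≡true j≤a = refl

conj-∷-> : ∀ {a j} L → a < j → conj (a ∷ L) j ≡ conj L j
conj-∷-> {a} {j} L a<j rewrite >⇒≤ᵇ≡false {j} {a} a<j = refl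

conj-≤-length : ∀ L j → conj L j ≤ length L
conj-≤-length [] j = z≤n
conj-≤-length (a ∷ L) j with j ≤ᵇ a
... | true = s≤s (conj-≤-length L j)
... | false = m≤n⇒m≤1+n (conj-≤-length L j)

part-≤-head : ∀ {a L} → Linked _≥_ (a ∷ L) → ∀ x → part L x ≤ a
part-≤-head {L = []} _ x = z≤n
part-≤-head {L = b ∷ L} (a≥b ∷ lk) zero = z≤n
part-≤-head {L = b ∷ L} (a≥b ∷ lk) (suc zero) = a≥b
part-≤-head {L = b ∷ L} (a≥b ∷ lk) (suc (suc x)) = ≤-trans (part-≤-head lk (suc x)) a≥b

conj-beyond-head : ∀ {a L j} → Linked _≥_ (a ∷ L) → a < j → conj L j ≡ 0
conj-beyond-head {L = []} _ _ = refl
conj-beyond-head {L = b ∷ L} (a≥b ∷ lk) a<j =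
  trans (conj-∷-> L (≤-<-trans a≥b a<j)) (conj-beyond-head lk (≤-<-trans a≥b a<j))

part-positive : ∀ {L} → All (1 ≤_) L → ∀ {x} → 1 ≤ x → x ≤ length L → 1 ≤ part L x
part-positive (1≤a ∷ _) {suc zero} _ _ = 1≤a
part-positive (_ ∷ pos) {suc (suc x)} _ (s≤s x≤n) = part-positive pos (s≤s z≤n) x≤n

zeros-after-zero : ∀ {M} → Linked _≥_ (0 ∷ M) → All (_≡ 0) M
zeros-after-zero {[]} _ = []
zeros-after-zero {_ ∷ _} (z≤n ∷ lk) = refl ∷ zeros-after-zero lk

dropZeros-zeros : ∀ {M} → All (_≡ 0) M → dropZeros M ≡ []
dropZeros-zeros [] = refl
dropZeros-zeros (refl ∷ zeros) = dropZeros-zeros zeros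

part-zeros : ∀ {M} → All (_≡ 0) M → ∀ x → part M x ≡ 0
part-zeros [] x = refl
part-zeros (_ ∷ _) zero = refl
part-zeros (refl ∷ _) (suc zero) = refl
part-zeros (_ ∷ zeros) (suc (suc x)) = part-zeros zeros (suc x)

rowsFrom-zeros : ∀ {g M} → (∀ r → g r 0 ≡ 0) → All (_≡ 0) M → ∀ i → All (_≡ 0) (rowsFrom g i M)
rowsFrom-zeros g0 [] i = []
rowsFrom-zeros g0 (refl ∷ zeros) i = g0 i ∷ rowsFrom-zeros g0 zeros (suc i)

dropZeros-linked : ∀ {M} → Linked _≥_ M → Linked _≥_ (dropZeros M)
dropZeros-linked {[]} _ = []
dropZeros-linked {zero ∷ M} lk rewrite dropZeros-zeros (zeros-after-zero lk) = []
dropZeros-linked {suc a ∷ []} _ = [-]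
dropZeros-linked {suc a ∷ zero ∷ M} (_ ∷ lk) rewrite dropZeros-zeros (zeros-after-zero lk) = [-]
dropZeros-linked {suc a ∷ suc b ∷ M} (b≤a ∷ lk) = b≤a ∷ dropZeros-linked lk

dropZeros-positive : ∀ M → All (1 ≤_) (dropZeros M)
dropZeros-positive [] = []
dropZeros-positive (zero ∷ M) = dropZeros-positive M
dropZeros-positive (suc a ∷ M) = s≤s z≤n ∷ dropZeros-positive M

length-dropZeros : ∀ M → length (dropZeros M) ≤ length M
length-dropZeros [] = z≤n
length-dropZeros (zero ∷ M) = m≤n⇒m≤1+n (length-dropZeros M)
length-dropZeros (suc a ∷ M) = s≤s (length-dropZeros M)

head0-dropZeros : ∀ {M} → Linked _≥_ M → head0 (dropZeros M) ≤ head0 M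
head0-dropZeros {[]} _ = z≤n
head0-dropZeros {zero ∷ M} lk rewrite dropZeros-zeros (zeros-after-zero lk) = z≤n
head0-dropZeros {suc a ∷ M} _ = ≤-refl

part-dropZeros : ∀ {M} → Linked _≥_ M → ∀ x → part (dropZeros M) x ≡ part M x
part-dropZeros {[]} _ x = refl
part-dropZeros {zero ∷ M} lk x rewrite dropZeros-zeros (zeros-after-zero lk) = sym (part-zeros (refl ∷ zeros-after-zero lk) x)
part-dropZeros {suc a ∷ M} lk zero = refl
part-dropZeros {suc a ∷ M} lk (suc zero) = refl
part-dropZeros {suc a ∷ M} lk (suc (suc x)) = part-dropZeros (tail lk) (suc x)

conj-dropZeros : ∀ M {y} → 1 ≤ y → conj (dropZeros M) y ≡ conj M y
conj-dropZeros [] _ = refl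
conj-dropZeros (zero ∷ M) {y} 1≤y = trans (conj-dropZeros M 1≤y) (sym (conj-∷-> M 1≤y))
conj-dropZeros (suc a ∷ M) {y} 1≤y with y ≤ᵇ suc a
... | true = cong suc (conj-dropZeros M 1≤y)
... | false = conj-dropZeros M 1≤y

part-map : ∀ {f} → f 0 ≡ 0 → ∀ M x → part (map f M) x ≡ f (part M x)
part-map f0 [] x = sym f0
part-map f0 (a ∷ M) zero = sym f0
part-map f0 (a ∷ M) (suc zero) = refl
part-map f0 (a ∷ M) (suc (suc x)) = part-map f0 M (suc x)

conj-map : ∀ {f y j} → (∀ b → (y ≤ᵇ f b) ≡ (j ≤ᵇ b)) → ∀ M → conj (map f M) y ≡ conj M j
conj-map y≤f⇔j≤ [] = refl
conj-map {j = j} y≤f⇔j≤ (a ∷ M) rewrite y≤f⇔j≤ a with j ≤ᵇ a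
... | true = cong suc (conj-map y≤f⇔j≤ M)
... | false = conj-map y≤f⇔j≤ M

rowsFrom-const : ∀ (f : ℕ → ℕ) i M → rowsFrom (λ _ a → f a) i M ≡ map f M
rowsFrom-const f i [] = refl
rowsFrom-const f i (a ∷ M) = cong (f a ∷_) (rowsFrom-const f (suc i) M)

rowsFrom-map : ∀ (g : ℕ → ℕ → ℕ) (f : ℕ → ℕ) i M → rowsFrom g i (map f M) ≡ rowsFrom (λ r a → g r (f a)) i M
rowsFrom-map g f i [] = refl
rowsFrom-map g f i (a ∷ M) = cong (g i (f a) ∷_) (rowsFrom-map g f (suc i) M)

map-rowsFrom : ∀ (h : ℕ → ℕ) (f : ℕ → ℕ → ℕ) i M → map h (rowsFrom f i M) ≡ rowsFrom (λ r a → h (f r a)) i M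
map-rowsFrom h f i [] = refl
map-rowsFrom h f i (a ∷ M) = cong (h (f i a) ∷_) (map-rowsFrom h f (suc i) M)

rowsFrom-cong : ∀ {F G : ℕ → ℕ → ℕ} i M →
  (∀ t → t < length M → F (i + t) (part M (suc t)) ≡ G (i + t) (part M (suc t))) →
  rowsFrom F i M ≡ rowsFrom G i M
rowsFrom-cong i [] _ = refl
rowsFrom-cong {F} {G} i (a ∷ M) F≡G = cong₂ _∷_
  (subst (λ r → F r a ≡ G r a) (+-identityʳ i) (F≡G 0 (s≤s z≤n)))
  (rowsFrom-cong (suc i) M λ t t<n → subst (λ r → F r (part M (suc t)) ≡ G r (part M (suc t))) (+-suc i t) (F≡G (suc t) (s≤s t<n)))

rowsFrom-dropZeros : ∀ {g : ℕ → ℕ → ℕ} {M} i → Linked _≥_ M → (∀ r → g r 0 ≡ 0) →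
  (∀ t → t < length M → 1 ≤ part M (suc t) → 1 ≤ g (i + t) (part M (suc t))) →
  rowsFrom g i (dropZeros M) ≡ dropZeros (rowsFrom g i M)
rowsFrom-dropZeros {M = []} i _ _ _ = refl
rowsFrom-dropZeros {g} {zero ∷ M} i lk g0 _ rewrite g0 i | dropZeros-zeros (zeros-after-zero lk) =
  sym (dropZeros-zeros (rowsFrom-zeros g0 (zeros-after-zero lk) (suc i)))
rowsFrom-dropZeros {g} {suc a ∷ M} i lk g0 pos
  with g i (suc a) | subst (λ r → 1 ≤ g r (suc a)) (+-identityʳ i) (pos 0 (s≤s z≤n) (s≤s z≤n))
... | suc b | _ = cong (suc b ∷_) (rowsFrom-dropZeros (suc i) (tail lk) g0 λ t t<n 1≤row →
  subst (λ r → 1 ≤ g r (part M (suc t))) (+-suc i t) (pos (suc t) (s≤s t<n) 1≤row))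

-- Hook lengths

leg-cancel : ∀ h x j p c Hj r a v →
  h + (x + j) ≡ p + c + 1 → Hj + (r + j) ≡ a + c + 1 → a + x ≡ v + p + r → h + v ≡ Hj
leg-cancel h x j p c Hj r a v e₁ e₂ e₃ = +-cancelʳ-≡ (x + (r + j)) (h + v) Hj (begin
  h + v + (x + (r + j))      ≡⟨ s₁ h v x r j ⟩
  (h + (x + j)) + (v + r)    ≡⟨ cong (_+ (v + r)) e₁ ⟩
  (p + c + 1) + (v + r)      ≡⟨ s₂ p c v r ⟩
  (v + p + r) + (c + 1)      ≡⟨ cong (_+ (c + 1)) e₃ ⟨
  (a + x) + (c + 1)          ≡⟨ s₃ a x c ⟩
  (a + c + 1) + x            ≡⟨ cong (_+ x) e₂ ⟨
  (Hj + (r + j)) + x         ≡⟨ s₄ Hj r j x ⟩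
  Hj + (x + (r + j))         ∎)
  where
  open ≡-Reasoning
  s₁ : ∀ h v x r j → h + v + (x + (r + j)) ≡ (h + (x + j)) + (v + r)
  s₁ = solve-∀
  s₂ : ∀ p c v r → (p + c + 1) + (v + r) ≡ (v + p + r) + (c + 1)
  s₂ = solve-∀
  s₃ : ∀ a x c → (a + x) + (c + 1) ≡ (a + c + 1) + x
  s₃ = solve-∀
  s₄ : ∀ Hj r j x → (Hj + (r + j)) + x ≡ Hj + (x + (r + j))
  s₄ = solve-∀

module Diagram {L : List ℕ} (lk : Linked _≥_ L) where

  ≤part⇒≤conj : ∀ {x j} → 1 ≤ x → 1 ≤ j → j ≤ part L x → x ≤ conj L j
  ≤part⇒≤conj = go lk
    where
    go : ∀ {L} → Linked _≥_ L → ∀ {x j} → 1 ≤ x → 1 ≤ j → j ≤ part L x → x ≤ conj L j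
    go {[]} _ {suc x} _ 1≤j j≤0 = ⊥-elim (<⇒≱ 1≤j j≤0)
    go {a ∷ L} _ {suc zero} _ _ j≤a rewrite conj-∷-≤ L j≤a = s≤s z≤n
    go {a ∷ L} lk {suc (suc x)} _ 1≤j j≤part
      rewrite conj-∷-≤ L (≤-trans j≤part (part-≤-head lk (suc x))) =
      s≤s (go (tail lk) (s≤s z≤n) 1≤j j≤part)

  ≤conj⇒≤part : ∀ {x j} → 1 ≤ x → 1 ≤ j → x ≤ conj L j → j ≤ part L x
  ≤conj⇒≤part = go lk
    where
    go : ∀ {L} → Linked _≥_ L → ∀ {x j} → 1 ≤ x → 1 ≤ j → x ≤ conj L j → j ≤ part L x
    go {a ∷ L} lk {suc x} {j} 1≤x 1≤j x≤conj with j ≤? a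
    ... | no j≰a rewrite conj-∷-> L (≰⇒> j≰a) | conj-beyond-head lk (≰⇒> j≰a) = ⊥-elim (<⇒≱ 1≤x x≤conj)
    go {a ∷ L} lk {suc zero} {j} 1≤x 1≤j x≤conj | yes j≤a = j≤a
    go {a ∷ L} lk {suc (suc x)} {j} 1≤x 1≤j x≤conj | yes j≤a rewrite conj-∷-≤ L j≤a =
      go (tail lk) (s≤s z≤n) 1≤j (s≤s⁻¹ x≤conj)

  part-antitone : ∀ {x x′} → 1 ≤ x → x ≤ x′ → part L x′ ≤ part L x
  part-antitone {x} {x′} 1≤x x≤x′ with part L x′ in px′
  ... | zero = z≤n
  ... | suc _ = ≤conj⇒≤part 1≤x (s≤s z≤n)
                  (≤-trans x≤x′ (≤part⇒≤conj (≤-trans 1≤x x≤x′) (s≤s z≤n) (≤-reflexive (sym px′))))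

  conj-antitone : ∀ {j j′} → 1 ≤ j → j ≤ j′ → conj L j′ ≤ conj L j
  conj-antitone {j} {j′} 1≤j j≤j′ with conj L j′ in cj′
  ... | zero = z≤n
  ... | suc _ = ≤part⇒≤conj (s≤s z≤n) 1≤j
                  (≤-trans j≤j′ (≤conj⇒≤part (s≤s z≤n) (≤-trans 1≤j j≤j′) (≤-reflexive (sym cj′))))

  isBox : ∀ {x y} → 1 ≤ x → 1 ≤ y → y ≤ part L x → IsBox L x y
  isBox 1≤x 1≤y y≤part = 1≤x , ≤-trans (≤part⇒≤conj 1≤x 1≤y y≤part) (conj-≤-length L _) , 1≤y , y≤part

  hook-+ : ∀ {x y} → 1 ≤ x → 1 ≤ y → y ≤ part L x → hook L x y + (x + y) ≡ part L x + conj L y + 1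
  hook-+ {x} {y} 1≤x 1≤y y≤part = m∸n+n≡m (begin
    x + y                   ≤⟨ +-mono-≤ (≤part⇒≤conj 1≤x 1≤y y≤part) y≤part ⟩
    conj L y + part L x     ≡⟨ +-comm (conj L y) (part L x) ⟩
    part L x + conj L y     ≤⟨ m≤m+n _ 1 ⟩
    part L x + conj L y + 1 ∎)
    where open ≤-Reasoning

  hook-column-difference : ∀ {x y j} → 1 ≤ x → 1 ≤ y → 1 ≤ j → j ≤ part L x → j ≤ part L y →
    hook L x j + (part L y + x) ≡ hook L y j + (part L x + y)
  hook-column-difference {x} {y} {j} 1≤x 1≤y 1≤j j≤px j≤py =
    +-cancelʳ-≡ ((x + j) + (y + j)) _ _ (begin
      hook L x j + (part L y + x) + ((x + j) + (y + j))   ≡⟨ regroup (hook L x j) (part L y) x y j ⟩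
      (hook L x j + (x + j)) + (part L y + x + (y + j))   ≡⟨ cong (_+ (part L y + x + (y + j))) (hook-+ 1≤x 1≤j j≤px) ⟩
      (part L x + conj L j + 1) + (part L y + x + (y + j)) ≡⟨ swap (part L x) (part L y) (conj L j) x y j ⟩
      (part L y + conj L j + 1) + (part L x + y + (x + j)) ≡⟨ cong (_+ (part L x + y + (x + j))) (hook-+ 1≤y 1≤j j≤py) ⟨
      (hook L y j + (y + j)) + (part L x + y + (x + j))   ≡⟨ regroup (hook L y j) (part L x) y x j ⟨
      hook L y j + (part L x + y) + ((y + j) + (x + j))   ≡⟨ cong (hook L y j + (part L x + y) +_) (+-comm (y + j) (x + j)) ⟩
      hook L y j + (part L x + y) + ((x + j) + (y + j))   ∎)
    where
    open ≡-Reasoning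
    regroup : ∀ h p x y j → h + (p + x) + ((x + j) + (y + j)) ≡ (h + (x + j)) + (p + x + (y + j))
    regroup = solve-∀
    swap : ∀ px py c x y j → (px + c + 1) + (py + x + (y + j)) ≡ (py + c + 1) + (px + y + (x + j))
    swap = solve-∀

  module Row {r : ℕ} (1≤r : 1 ≤ r) where

    a : ℕ
    a = part L r

    H : ℕ → ℕ
    H = hook L r

    hook-+ʳ : ∀ {j} → 1 ≤ j → j ≤ a → H j + (r + j) ≡ a + conj L j + 1
    hook-+ʳ 1≤j j≤a = hook-+ 1≤r 1≤j j≤a

    hook-decreasing : ∀ {j j′} → 1 ≤ j → j < j′ → j′ ≤ a → H j′ < H j
    hook-decreasing {j} {j′} 1≤j j<j′ j′≤a = +-cancelʳ-< (r + j′) (H j′) (H j) (begin-strict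
      H j′ + (r + j′)     ≡⟨ hook-+ʳ (≤-trans 1≤j (<⇒≤ j<j′)) j′≤a ⟩
      a + conj L j′ + 1   ≤⟨ +-monoˡ-≤ 1 (+-monoʳ-≤ a (conj-antitone 1≤j (<⇒≤ j<j′))) ⟩
      a + conj L j + 1    ≡⟨ hook-+ʳ 1≤j (≤-trans (<⇒≤ j<j′) j′≤a) ⟨
      H j + (r + j)       <⟨ +-monoʳ-< (H j) (+-monoʳ-< r j<j′) ⟩
      H j + (r + j′)      ∎)
      where open ≤-Reasoning

    hook-antitone : ∀ {j j′} → 1 ≤ j → j ≤ j′ → j′ ≤ a → H j′ ≤ H j
    hook-antitone 1≤j j≤j′ j′≤a with m≤n⇒m<n∨m≡n j≤j′
    ... | inj₁ j<j′ = <⇒≤ (hook-decreasing 1≤j j<j′ j′≤a)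
    ... | inj₂ refl = ≤-refl

    hook-injective : ∀ {j j′} → 1 ≤ j → j ≤ a → 1 ≤ j′ → j′ ≤ a → H j ≡ H j′ → j ≡ j′
    hook-injective {j} {j′} 1≤j j≤a 1≤j′ j′≤a Hj≡Hj′ with <-cmp j j′
    ... | tri< j<j′ _ _ = ⊥-elim (<⇒≢ (hook-decreasing 1≤j j<j′ j′≤a) (sym Hj≡Hj′))
    ... | tri≈ _ j≡j′ _ = j≡j′
    ... | tri> _ _ j′<j = ⊥-elim (<⇒≢ (hook-decreasing 1≤j′ j′<j j≤a) Hj≡Hj′)

    arm<hook : ∀ {j} → 1 ≤ j → j ≤ a → a ∸ j < H j
    arm<hook {j} 1≤j j≤a = +-cancelʳ-< (r + j) (a ∸ j) (H j) (begin-strict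
      a ∸ j + (r + j)     ≡⟨ cong (a ∸ j +_) (+-comm r j) ⟩
      a ∸ j + (j + r)     ≡⟨ +-assoc (a ∸ j) j r ⟨
      a ∸ j + j + r       ≡⟨ cong (_+ r) (m∸n+n≡m j≤a) ⟩
      a + r               ≤⟨ +-monoʳ-≤ a (≤part⇒≤conj 1≤r 1≤j j≤a) ⟩
      a + conj L j        <⟨ m<m+n (a + conj L j) (s≤s z≤n) ⟩
      a + conj L j + 1    ≡⟨ hook-+ʳ 1≤j j≤a ⟨
      H j + (r + j)       ∎)
      where open ≤-Reasoning

    conj-beyond-row : conj L (suc a) < r
    conj-beyond-row = ≰⇒> λ r≤conj → 1+n≰n (≤conj⇒≤part 1≤r (s≤s z≤n) r≤conj)

    -- a + x ≡ v + λₓ + r says v = H j − hook L x j for every column j ≤ λₓ; unlike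
    -- that difference, it does not depend on j.
    Leg : ℕ → ℕ → Set
    Leg j v = Σ ℕ λ x → 1 ≤ x × j ≤ part L x × a + x ≡ v + part L x + r

    leg-at : ∀ {j v} → 1 ≤ j → j ≤ a → v < H j → a + conj L (suc j) < v + (r + j) → Leg j v
    leg-at {j} {v} 1≤j j≤a v<Hj bound = x , 1≤x , ≤-reflexive (sym px≡j) , a+x≡
      where
      x : ℕ
      x = v + (r + j) ∸ a
      x+a≡ : x + a ≡ v + (r + j)
      x+a≡ = m∸n+n≡m (≤-trans (m≤m+n a _) (<⇒≤ bound))
      conj<x : conj L (suc j) < x
      conj<x = +-cancelʳ-< a _ _ (subst₂ _<_ (+-comm a _) (sym x+a≡) bound)
      1≤x : 1 ≤ x
      1≤x = ≤-trans (s≤s z≤n) conj<x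
      x≤conj : x ≤ conj L j
      x≤conj = s≤s⁻¹ (+-cancelʳ-< a x (suc (conj L j)) (begin-strict
        x + a             ≡⟨ x+a≡ ⟩
        v + (r + j)       <⟨ +-monoˡ-< (r + j) v<Hj ⟩
        H j + (r + j)     ≡⟨ hook-+ʳ 1≤j j≤a ⟩
        a + conj L j + 1  ≡⟨ trans (+-comm (a + conj L j) 1) (cong suc (+-comm a (conj L j))) ⟩
        suc (conj L j) + a ∎))
        where open ≤-Reasoning
      px≡j : part L x ≡ j
      px≡j = ≤-antisym (≮⇒≥ λ j<px → <⇒≱ conj<x (≤part⇒≤conj 1≤x (s≤s z≤n) j<px))
                       (≤conj⇒≤part 1≤x 1≤j x≤conj)
      a+x≡ : a + x ≡ v + part L x + r
      a+x≡ rewrite px≡j = trans (+-comm a x) (trans x+a≡ (rearrange v r j))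
        where
        rearrange : ∀ v r j → v + (r + j) ≡ v + j + r
        rearrange = solve-∀

    hook-values : ∀ n {j v} → 1 ≤ j → j + n ≡ a → 1 ≤ v → v < H j →
      Σ ℕ (λ j′ → j < j′ × j′ ≤ a × H j′ ≡ v) ⊎ Leg j v
    hook-values zero {j} {v} 1≤j j+0≡a 1≤v v<Hj with refl ← trans (sym (+-identityʳ j)) j+0≡a =
      inj₂ (leg-at 1≤j ≤-refl v<Hj (begin-strict
        a + conj L (suc a) <⟨ +-monoʳ-< a conj-beyond-row ⟩
        a + r              ≡⟨ +-comm a r ⟩
        r + a              ≤⟨ m≤n+m (r + a) v ⟩
        v + (r + a)        ∎))
      where open ≤-Reasoning
    hook-values (suc n) {j} {v} 1≤j j+1+n≡a 1≤v v<Hj =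
      step (≤-trans (m≤m+n (suc j) n) (≤-reflexive (trans (sym (+-suc j n)) j+1+n≡a)))
      where
      step : suc j ≤ a → Σ ℕ (λ j′ → j < j′ × j′ ≤ a × H j′ ≡ v) ⊎ Leg j v
      step 1+j≤a with <-cmp v (H (suc j))
      ... | tri< v<H′ _ _ =
        Sum.map (λ (j′ , 1+j<j′ , j′≤a , Hj′≡v) → j′ , <-trans (n<1+n j) 1+j<j′ , j′≤a , Hj′≡v)
                (λ (x , 1≤x , 1+j≤px , eq) → x , 1≤x , ≤-trans (n≤1+n j) 1+j≤px , eq)
                (hook-values n (s≤s z≤n) (trans (sym (+-suc j n)) j+1+n≡a) 1≤v v<H′)
      ... | tri≈ _ v≡H′ _ = inj₁ (suc j , ≤-refl , 1+j≤a , sym v≡H′)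
      ... | tri> _ _ H′<v = inj₂ (leg-at 1≤j (≤-trans (n≤1+n j) 1+j≤a) v<Hj (s≤s⁻¹ (begin-strict
          suc (a + conj L (suc j))   ≡⟨ +-comm 1 (a + conj L (suc j)) ⟩
          a + conj L (suc j) + 1     ≡⟨ hook-+ʳ (s≤s z≤n) 1+j≤a ⟨
          H (suc j) + (r + suc j)    <⟨ +-monoˡ-< (r + suc j) H′<v ⟩
          v + (r + suc j)            ≡⟨ trans (cong (v +_) (+-suc r j)) (+-suc v (r + j)) ⟩
          suc (v + (r + j))          ∎)))
        where open ≤-Reasoning

    below-hook : ∀ {j v} → 1 ≤ j → j ≤ a → 1 ≤ v → v < H j →
      Σ ℕ (λ j′ → j < j′ × j′ ≤ a × H j′ ≡ v)
      ⊎ Σ ℕ (λ x → 1 ≤ x × j ≤ part L x × hook L x j + v ≡ H j)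
    below-hook {j} {v} 1≤j j≤a 1≤v v<Hj =
      Sum.map₂ leg-hook (hook-values (a ∸ j) 1≤j (m+[n∸m]≡n j≤a) 1≤v v<Hj)
      where
      leg-hook : Leg j v → Σ ℕ (λ x → 1 ≤ x × j ≤ part L x × hook L x j + v ≡ H j)
      leg-hook (x , 1≤x , j≤px , a+x≡) =
        x , 1≤x , j≤px ,
        leg-cancel (hook L x j) x j (part L x) (conj L j) (H j) r a v (hook-+ 1≤x 1≤j j≤px) (hook-+ʳ 1≤j j≤a) a+x≡

-- Congruence modulo ℓ

module Congruence (ℓ : ℕ) {{_ : NonZero ℓ}} where

  ∣∸⇒%≡% : ∀ {a b} → a ≤ b → ℓ ∣ b ∸ a → a % ℓ ≡ b % ℓ
  ∣∸⇒%≡% {a} {b} a≤b ℓ∣b∸a = begin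
    a % ℓ             ≡⟨ %-remove-+ʳ a ℓ∣b∸a ⟨
    (a + (b ∸ a)) % ℓ ≡⟨ cong (_% ℓ) (m+[n∸m]≡n a≤b) ⟩
    b % ℓ             ∎
    where open ≡-Reasoning

  %≡%⇒∣∸ : ∀ {a b} → a ≤ b → a % ℓ ≡ b % ℓ → ℓ ∣ b ∸ a
  %≡%⇒∣∸ {a} {b} a≤b a%≡b% = divides (b / ℓ ∸ a / ℓ) (begin
    b ∸ a                                               ≡⟨ cong₂ _∸_ (m≡m%n+[m/n]*n b ℓ) (m≡m%n+[m/n]*n a ℓ) ⟩
    (b % ℓ + (b / ℓ) * ℓ) ∸ (a % ℓ + (a / ℓ) * ℓ)       ≡⟨ cong (λ t → (t + (b / ℓ) * ℓ) ∸ (a % ℓ + (a / ℓ) * ℓ)) a%≡b% ⟨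
    (a % ℓ + (b / ℓ) * ℓ) ∸ (a % ℓ + (a / ℓ) * ℓ)       ≡⟨ [m+n]∸[m+o]≡n∸o (a % ℓ) _ _ ⟩
    (b / ℓ) * ℓ ∸ (a / ℓ) * ℓ                           ≡⟨ *-distribʳ-∸ ℓ (b / ℓ) (a / ℓ) ⟨
    (b / ℓ ∸ a / ℓ) * ℓ                                 ∎)
    where open ≡-Reasoning

  congMod≡true⇔%≡% : ∀ a b → congMod ℓ a b ≡ true ⇔ a % ℓ ≡ b % ℓ
  congMod≡true⇔%≡% a b with ≤-total a b
  ... | inj₁ a≤b rewrite m≤n⇒m∸n≡0 a≤b =
    ⇔-trans (does≡true⇔ (ℓ ∣? (b ∸ a))) (mk⇔ (∣∸⇒%≡% a≤b) (%≡%⇒∣∸ a≤b))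
  ... | inj₂ b≤a rewrite m≤n⇒m∸n≡0 b≤a | +-identityʳ (a ∸ b) =
    ⇔-trans (does≡true⇔ (ℓ ∣? (a ∸ b))) (mk⇔ (sym ∘ ∣∸⇒%≡% b≤a) (%≡%⇒∣∸ b≤a ∘ sym))

  congMod-+ʳ : ∀ a b c → congMod ℓ (a + c) (b + c) ≡ congMod ℓ a b
  congMod-+ʳ a b c = cong₂ (λ x y → does (ℓ ∣? (x + y))) (+ʳ-∸ a b) (+ʳ-∸ b a)
    where
    +ʳ-∸ : ∀ x y → x + c ∸ (y + c) ≡ x ∸ y
    +ʳ-∸ x y = trans (cong₂ _∸_ (+-comm x c) (+-comm y c)) ([m+n]∸[m+o]≡n∸o c x y)

  b<a<b+ℓ⇒%≢% : ∀ {a b} → b < a → a < b + ℓ → a % ℓ ≢ b % ℓ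
  b<a<b+ℓ⇒%≢% {a} {b} b<a a<b+ℓ a%≡b% = <⇒≱ (m<n+o⇒m∸n<o a b a<b+ℓ) (∣⇒≤ ℓ∣a∸b)
    where
    instance _ = >-nonZero (m<n⇒0<n∸m b<a)
    ℓ∣a∸b : ℓ ∣ a ∸ b
    ℓ∣a∸b = %≡%⇒∣∸ (<⇒≤ b<a) (sym a%≡b%)

-- Deleting the columns of Φ̃

compressed-hook-+ : ∀ h H r j k d a ka da c →
  h + (r + k) ≡ ka + c + 1 → H + (r + j) ≡ a + c + 1 → k + d ≡ j → ka + da ≡ a → h + da ≡ H + d
compressed-hook-+ h H r j k d a ka da c e₁ e₂ e₃ e₄ = +-cancelʳ-≡ (r + k) (h + da) (H + d) (begin
  h + da + (r + k)          ≡⟨ s₁ h da r k ⟩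
  (h + (r + k)) + da        ≡⟨ cong (_+ da) e₁ ⟩
  (ka + c + 1) + da         ≡⟨ s₂ ka c da ⟩
  (ka + da) + c + 1         ≡⟨ cong (λ t → t + c + 1) e₄ ⟩
  a + c + 1                 ≡⟨ e₂ ⟨
  H + (r + j)               ≡⟨ cong (λ t → H + (r + t)) e₃ ⟨
  H + (r + (k + d))         ≡⟨ s₃ H r k d ⟩
  H + d + (r + k)           ∎)
  where
  open ≡-Reasoning
  s₁ : ∀ h da r k → h + da + (r + k) ≡ (h + (r + k)) + da
  s₁ = solve-∀
  s₂ : ∀ ka c da → (ka + c + 1) + da ≡ (ka + da) + c + 1
  s₂ = solve-∀
  s₃ : ∀ H r k d → H + (r + (k + d)) ≡ H + d + (r + k)
  s₃ = solve-∀

module Compression {L : List ℕ} (lk : Linked _≥_ L) (ℓ : ℕ) {{_ : NonZero ℓ}} (core : IsCore ℓ L) where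
  open Diagram lk
  open Congruence ℓ

  hook≢ℓ : ∀ {x y} → 1 ≤ x → 1 ≤ y → y ≤ part L x → hook L x y ≢ ℓ
  hook≢ℓ 1≤x 1≤y y≤px h≡ℓ = core _ _ (isBox 1≤x 1≤y y≤px) (∣-reflexive (sym h≡ℓ))

  keep : ℕ → Bool
  keep j = not (congMod ℓ (hook L 1 j) (hook L 1 1))

  K D : ℕ → ℕ
  K = countUpTo keep
  D = countUpTo (λ j → not (keep j))

  μ : List ℕ
  μ = Φ̃ ℓ L

  μ≡ : μ ≡ dropZeros (map K L)
  μ≡ = cong dropZeros (rowsFrom-const K 1 L)

  K-linked : Linked _≥_ (map K L)
  K-linked = map⁺ (Linked.map (countUpTo-mono keep) lk)

  part-μ : ∀ x → part μ x ≡ K (part L x)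
  part-μ x rewrite μ≡ = trans (part-dropZeros K-linked x) (part-map refl L x)

  K-≤ᵇ : ∀ {j} → 1 ≤ j → keep j ≡ true → ∀ b → (K j ≤ᵇ K b) ≡ (j ≤ᵇ b)
  K-≤ᵇ {j@(suc j-1)} _ kj b with j ≤? b
  ... | yes j≤b rewrite ≤⇒≤ᵇ≡true j≤b = ≤⇒≤ᵇ≡true (countUpTo-mono keep j≤b)
  ... | no j≰b rewrite >⇒≤ᵇ≡false (≰⇒> j≰b) = >⇒≤ᵇ≡false (countUpTo-strict keep (s≤s⁻¹ (≰⇒> j≰b)) kj)

  conj-μ : ∀ {j} → 1 ≤ j → keep j ≡ true → conj μ (K j) ≡ conj L j
  conj-μ 1≤j kj rewrite μ≡ =
    trans (conj-dropZeros (map K L) (countUpTo-positive keep 1≤j ≤-refl kj)) (conj-map (K-≤ᵇ 1≤j kj) L)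

  module CompressedRow {r : ℕ} (1≤r : 1 ≤ r) (1≤a : 1 ≤ part L r) where
    open Row 1≤r

    ℓ<hook : ∀ {j} → 1 ≤ j → j ≤ a → ℓ ≤ H j → ℓ < H j
    ℓ<hook 1≤j j≤a ℓ≤Hj = ≤∧≢⇒< ℓ≤Hj (hook≢ℓ 1≤r 1≤j j≤a ∘ sym)

    hook-drop : ∀ {j} → 1 ≤ j → j ≤ a → ℓ < H j → Σ ℕ λ j′ → j < j′ × j′ ≤ a × H j′ + ℓ ≡ H j
    hook-drop {j} 1≤j j≤a ℓ<Hj with below-hook 1≤j j≤a (m<n⇒0<n∸m ℓ<Hj) (∸-monoʳ-< (>-nonZero⁻¹ ℓ) (<⇒≤ ℓ<Hj))
    ... | inj₁ (j′ , j<j′ , j′≤a , Hj′≡) = j′ , j<j′ , j′≤a , trans (cong (_+ ℓ) Hj′≡) (m∸n+n≡m (<⇒≤ ℓ<Hj))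
    ... | inj₂ (x , 1≤x , j≤px , hx+v≡Hj) = ⊥-elim (hook≢ℓ 1≤x 1≤j j≤px
      (+-cancelʳ-≡ (H j ∸ ℓ) _ _ (trans hx+v≡Hj (sym (m+[n∸m]≡n (<⇒≤ ℓ<Hj))))))

    small-representative : ∀ {j} → 1 ≤ j → j ≤ a →
      Σ ℕ λ j₀ → j ≤ j₀ × j₀ ≤ a × H j₀ < ℓ × H j₀ % ℓ ≡ H j % ℓ
    small-representative {j} = go (suc (H j)) ≤-refl
      where
      go : ∀ n {j} → H j < n → 1 ≤ j → j ≤ a → Σ ℕ λ j₀ → j ≤ j₀ × j₀ ≤ a × H j₀ < ℓ × H j₀ % ℓ ≡ H j % ℓ
      go (suc n) {j} Hj<1+n 1≤j j≤a with H j <? ℓ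
      ... | yes Hj<ℓ = j , ≤-refl , j≤a , Hj<ℓ , refl
      ... | no Hj≮ℓ with hook-drop 1≤j j≤a (ℓ<hook 1≤j j≤a (≮⇒≥ Hj≮ℓ))
      ... | j′ , j<j′ , j′≤a , Hj′+ℓ≡Hj with go n Hj′<n (≤-trans 1≤j (<⇒≤ j<j′)) j′≤a
        where
        Hj′<n : H j′ < n
        Hj′<n = <-≤-trans (subst (H j′ <_) Hj′+ℓ≡Hj (m<m+n (H j′) (>-nonZero⁻¹ ℓ))) (s≤s⁻¹ Hj<1+n)
      ... | j₀ , j′≤j₀ , j₀≤a , Hj₀<ℓ , Hj₀≡Hj′ =
        j₀ , ≤-trans (<⇒≤ j<j′) j′≤j₀ , j₀≤a , Hj₀<ℓ ,
        trans Hj₀≡Hj′ (trans (sym ([m+n]%n≡m%n (H j′) ℓ)) (cong (_% ℓ) Hj′+ℓ≡Hj))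

    keep-row : ∀ {j} → 1 ≤ j → j ≤ a → keep j ≡ not (congMod ℓ (H j) (H 1))
    keep-row {j} 1≤j j≤a = cong not (begin
      congMod ℓ (hook L 1 j) (hook L 1 1)                        ≡⟨ congMod-+ʳ (hook L 1 j) (hook L 1 1) (a + 1) ⟨
      congMod ℓ (hook L 1 j + (a + 1)) (hook L 1 1 + (a + 1))     ≡⟨ cong₂ (congMod ℓ) (shift 1≤j j≤a) (shift (s≤s z≤n) 1≤a) ⟩
      congMod ℓ (H j + (part L 1 + r)) (H 1 + (part L 1 + r))     ≡⟨ congMod-+ʳ (H j) (H 1) (part L 1 + r) ⟩
      congMod ℓ (H j) (H 1)                                      ∎)
      where
      open ≡-Reasoning
      shift : ∀ {y} → 1 ≤ y → y ≤ a → hook L 1 y + (a + 1) ≡ H y + (part L 1 + r)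
      shift 1≤y y≤a = hook-column-difference (s≤s z≤n) 1≤r 1≤y (≤-trans y≤a (part-antitone (s≤s z≤n) 1≤r)) y≤a

    deleted⇒%≡ : ∀ {j} → 1 ≤ j → j ≤ a → keep j ≡ false → H j % ℓ ≡ H 1 % ℓ
    deleted⇒%≡ 1≤j j≤a kj = Equivalence.to (congMod≡true⇔%≡% (H _) (H 1)) (not-injective (trans (sym (keep-row 1≤j j≤a)) kj))

    %≡⇒deleted : ∀ {j} → 1 ≤ j → j ≤ a → H j % ℓ ≡ H 1 % ℓ → keep j ≡ false
    %≡⇒deleted 1≤j j≤a e = trans (keep-row 1≤j j≤a) (cong not (Equivalence.from (congMod≡true⇔%≡% (H _) (H 1)) e))

    small-deleted : Σ ℕ λ j₀ → 1 ≤ j₀ × j₀ ≤ a × H j₀ < ℓ × keep j₀ ≡ false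
    small-deleted with small-representative (s≤s z≤n) 1≤a
    ... | j₀ , 1≤j₀ , j₀≤a , Hj₀<ℓ , Hj₀≡H₁ = j₀ , 1≤j₀ , j₀≤a , Hj₀<ℓ , %≡⇒deleted 1≤j₀ j₀≤a Hj₀≡H₁

    small-deleted-unique : ∀ {j j′} → 1 ≤ j → j ≤ a → 1 ≤ j′ → j′ ≤ a → H j < ℓ → H j′ < ℓ →
      keep j ≡ false → keep j′ ≡ false → j ≡ j′
    small-deleted-unique {j} {j′} 1≤j j≤a 1≤j′ j′≤a Hj<ℓ Hj′<ℓ kj kj′ = hook-injective 1≤j j≤a 1≤j′ j′≤a (begin
      H j       ≡⟨ m<n⇒m%n≡m Hj<ℓ ⟨
      H j % ℓ   ≡⟨ deleted⇒%≡ 1≤j j≤a kj ⟩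
      H 1 % ℓ   ≡⟨ deleted⇒%≡ 1≤j′ j′≤a kj′ ⟨
      H j′ % ℓ  ≡⟨ m<n⇒m%n≡m Hj′<ℓ ⟩
      H j′      ∎)
      where open ≡-Reasoning

    hμ : ℕ → ℕ
    hμ j = hook μ r (K j)

    -- Column j survives as column K j with the same leg, while its arm loses the
    -- deleted columns to the right of j.
    hμ-+ : ∀ {j} → 1 ≤ j → j ≤ a → keep j ≡ true → hμ j + D a ≡ H j + D j
    hμ-+ {j} 1≤j j≤a kj = compressed-hook-+ (hμ j) (H j) r j (K j) (D j) a (K a) (D a) (conj L j)
      hμ-+′ (hook-+ʳ 1≤j j≤a) (countUpTo-complement keep j) (countUpTo-complement keep a)
      where
      hμ-+′ : hμ j + (r + K j) ≡ K a + conj L j + 1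
      hμ-+′ rewrite part-μ r | conj-μ 1≤j kj =
        m∸n+n≡m (≤-trans (+-mono-≤ (≤part⇒≤conj 1≤r 1≤j j≤a) (countUpTo-mono keep j≤a))
                         (≤-trans (≤-reflexive (+-comm (conj L j) (K a))) (m≤m+n _ 1)))

    hμ≤hook : ∀ {j} → 1 ≤ j → j ≤ a → keep j ≡ true → hμ j ≤ H j
    hμ≤hook 1≤j j≤a kj = +-cancelʳ-≤ (D a) _ _
      (≤-trans (≤-reflexive (hμ-+ 1≤j j≤a kj)) (+-monoʳ-≤ _ (countUpTo-mono _ j≤a)))

    hμ<hook : ∀ {j j′} → 1 ≤ j → j < j′ → j′ ≤ a → keep j ≡ true → keep j′ ≡ false → hμ j < H j
    hμ<hook {j} {suc j′} 1≤j (s≤s j≤j′) j′≤a kj kj′ = +-cancelʳ-< (D a) _ _ (begin-strict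
      hμ j + D a   ≡⟨ hμ-+ 1≤j (≤-trans (n≤1+n j) (≤-trans (s≤s j≤j′) j′≤a)) kj ⟩
      H j + D j    <⟨ +-monoʳ-< (H j) (<-≤-trans (countUpTo-strict _ j≤j′ (cong not kj′)) (countUpTo-mono _ j′≤a)) ⟩
      H j + D a    ∎)
      where open ≤-Reasoning

    hook<ℓ⇒hμ<ℓ∸1 : ∀ {j} → 1 ≤ j → j ≤ a → keep j ≡ true → H j < ℓ → hμ j < ℓ ∸ 1
    hook<ℓ⇒hμ<ℓ∸1 {j} 1≤j j≤a kj Hj<ℓ with small-deleted
    ... | j₀ , 1≤j₀ , j₀≤a , Hj₀<ℓ , kj₀ with <-cmp j j₀
    ... | tri< j<j₀ _ _ = <-≤-trans (hμ<hook 1≤j j<j₀ j₀≤a kj kj₀) (<⇒≤pred Hj<ℓ)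
    ... | tri≈ _ refl _ = ⊥-elim (not-¬ kj kj₀)
    ... | tri> _ _ j₀<j = ≤-<-trans (hμ≤hook 1≤j j≤a kj) (<-≤-trans (hook-decreasing 1≤j₀ j₀<j j≤a) (<⇒≤pred Hj₀<ℓ))

    deleted-at-most-once : ∀ {j j′} → 1 ≤ j → j ≤ j′ → j′ ≤ a → H j ≤ H j′ + ℓ → D j′ ≤ suc (D j)
    deleted-at-most-once {j} {j′} 1≤j j≤j′ j′≤a Hj≤Hj′+ℓ = countUpTo-atMostOne _ j≤j′ λ y y′ j<y y≤j′ j<y′ y′≤j′ dy dy′ →
      case <-cmp y y′ of λ where
        (tri< y<y′ _ _) → ⊥-elim (separated j<y y<y′ y′≤j′ dy dy′)
        (tri≈ _ y≡y′ _) → y≡y′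
        (tri> _ _ y′<y) → ⊥-elim (separated j<y′ y′<y y≤j′ dy′ dy)
      where
      separated : ∀ {y y′} → j < y → y < y′ → y′ ≤ j′ → not (keep y) ≡ true → not (keep y′) ≡ true → ⊥
      separated {y} {y′} j<y y<y′ y′≤j′ dy dy′ = b<a<b+ℓ⇒%≢% (hook-decreasing 1≤y y<y′ y′≤a) (begin-strict
          H y        <⟨ hook-decreasing 1≤j j<y (≤-trans (<⇒≤ y<y′) y′≤a) ⟩
          H j        ≤⟨ Hj≤Hj′+ℓ ⟩
          H j′ + ℓ   ≤⟨ +-monoˡ-≤ ℓ (hook-antitone (≤-trans 1≤y (<⇒≤ y<y′)) y′≤j′ j′≤a) ⟩
          H y′ + ℓ   ∎)
        (trans (deleted⇒%≡ 1≤y (≤-trans (<⇒≤ y<y′) y′≤a) (not-injective dy))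
               (sym (deleted⇒%≡ (≤-trans 1≤y (<⇒≤ y<y′)) y′≤a (not-injective dy′))))
        where
        open ≤-Reasoning
        1≤y : 1 ≤ y
        1≤y = ≤-trans 1≤j (<⇒≤ j<y)
        y′≤a : y′ ≤ a
        y′≤a = ≤-trans y′≤j′ j′≤a

    -- Between j and the column j′ with H j′ = H j − ℓ at most one column is
    -- deleted, and fewer than H j′ columns lie to the right of j′.
    ℓ≤hook⇒ℓ≤hμ : ∀ {j} → 1 ≤ j → j ≤ a → keep j ≡ true → ℓ ≤ H j → ℓ ≤ hμ j
    ℓ≤hook⇒ℓ≤hμ {j} 1≤j j≤a kj ℓ≤Hj with hook-drop 1≤j j≤a (ℓ<hook 1≤j j≤a ℓ≤Hj)
    ... | j′ , j<j′ , j′≤a , Hj′+ℓ≡Hj = +-cancelʳ-≤ (D a) ℓ (hμ j) (begin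
      ℓ + D a              ≤⟨ +-monoʳ-≤ ℓ Da≤ ⟩
      ℓ + (H j′ + D j)     ≡⟨ +-assoc ℓ (H j′) (D j) ⟨
      ℓ + H j′ + D j       ≡⟨ cong (_+ D j) (trans (+-comm ℓ (H j′)) Hj′+ℓ≡Hj) ⟩
      H j + D j            ≡⟨ hμ-+ 1≤j j≤a kj ⟨
      hμ j + D a           ∎)
      where
      open ≤-Reasoning
      Da≤ : D a ≤ H j′ + D j
      Da≤ = s≤s⁻¹ (begin-strict
        D a                  ≤⟨ countUpTo-≤-+∸ _ j′≤a ⟩
        D j′ + (a ∸ j′)      <⟨ +-monoʳ-< (D j′) (arm<hook (≤-trans 1≤j (<⇒≤ j<j′)) j′≤a) ⟩
        D j′ + H j′          ≤⟨ +-monoˡ-≤ (H j′) (deleted-at-most-once 1≤j (<⇒≤ j<j′) j′≤a (≤-reflexive (sym Hj′+ℓ≡Hj))) ⟩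
        suc (D j + H j′)     ≡⟨ cong suc (+-comm (D j) (H j′)) ⟩
        suc (H j′ + D j)     ∎)

    keptSmall deletedSmall : ℕ → Bool
    keptSmall j = keep j ∧ (hμ j <ᵇ ℓ ∸ 1)
    deletedSmall j = not (keep j) ∧ (H j <ᵇ ℓ)

    small-split : ∀ j → 1 ≤ j → j ≤ a → indicator (H j <ᵇ ℓ) ≡ indicator (keptSmall j) + indicator (deletedSmall j)
    small-split j 1≤j j≤a = indicator-split (keep j) (H j <ᵇ ℓ) (hμ j <ᵇ ℓ ∸ 1) λ kj → case H j <? ℓ of λ where
      (yes Hj<ℓ) → trans (<⇒<ᵇ≡true Hj<ℓ) (sym (<⇒<ᵇ≡true (hook<ℓ⇒hμ<ℓ∸1 1≤j j≤a kj Hj<ℓ)))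
      (no Hj≮ℓ) → trans (≥⇒<ᵇ≡false (≮⇒≥ Hj≮ℓ))
                        (sym (≥⇒<ᵇ≡false (≤-trans (m∸n≤m ℓ 1) (ℓ≤hook⇒ℓ≤hμ 1≤j j≤a kj (≮⇒≥ Hj≮ℓ)))))

    deletedSmall-count : countUpTo deletedSmall a ≡ 1
    deletedSmall-count with small-deleted
    ... | j₀ , 1≤j₀ , j₀≤a , Hj₀<ℓ , kj₀ =
      countUpTo-unique deletedSmall j₀ 1≤j₀ j₀≤a (cong₂ _∧_ (cong not kj₀) (<⇒<ᵇ≡true Hj₀<ℓ)) unique
      where
      unique : ∀ j → 1 ≤ j → j ≤ a → deletedSmall j ≡ true → j ≡ j₀
      unique j 1≤j j≤a dsj with ∧≡true⇒ dsj
      ... | dj , Hj<ℓ = small-deleted-unique 1≤j j≤a 1≤j₀ j₀≤a (<ᵇ≡true⇒< Hj<ℓ) Hj₀<ℓ (not-injective dj) kj₀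

    row-identity : countUpTo (λ y → hook μ r y <ᵇ ℓ ∸ 1) (K a) ≡ countUpTo (λ j → H j <ᵇ ℓ) a ∸ 1
    row-identity = begin
      countUpTo (λ y → hook μ r y <ᵇ ℓ ∸ 1) (K a)               ≡⟨ countUpTo-reindex (λ y → hook μ r y <ᵇ ℓ ∸ 1) keep a ⟩
      countUpTo keptSmall a                                     ≡⟨ m+n∸n≡m _ 1 ⟨
      countUpTo keptSmall a + 1 ∸ 1                             ≡⟨ cong (λ t → countUpTo keptSmall a + t ∸ 1) deletedSmall-count ⟨
      countUpTo keptSmall a + countUpTo deletedSmall a ∸ 1      ≡⟨ cong (_∸ 1) (countUpTo-split (λ j → H j <ᵇ ℓ) keptSmall deletedSmall a small-split) ⟨
      countUpTo (λ j → H j <ᵇ ℓ) a ∸ 1                          ∎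
      where open ≡-Reasoning

    row-positive : 1 ≤ K a → 1 ≤ countUpTo (λ y → hook μ r y <ᵇ ℓ ∸ 1) (K a)
    row-positive 1≤Ka with countUpTo-witness keep a 1≤Ka
    ... | j , 1≤j , j≤a , kj with small-representative 1≤j j≤a
    ... | j′ , j≤j′ , j′≤a , Hj′<ℓ , Hj′≡Hj =
      subst (1 ≤_) (sym (countUpTo-reindex (λ y → hook μ r y <ᵇ ℓ ∸ 1) keep a)) (countUpTo-positive keptSmall 1≤j′ j′≤a keptSmall-j′)
      where
      1≤j′ : 1 ≤ j′
      1≤j′ = ≤-trans 1≤j j≤j′
      kj′ : keep j′ ≡ true
      kj′ with keep j′ in e
      ... | true = refl
      ... | false = ⊥-elim (not-¬ kj (%≡⇒deleted 1≤j j≤a (trans (sym Hj′≡Hj) (deleted⇒%≡ 1≤j′ j′≤a e))))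
      keptSmall-j′ : keptSmall j′ ≡ true
      keptSmall-j′ = cong₂ _∧_ kj′ (<⇒<ᵇ≡true (hook<ℓ⇒hμ<ℓ∸1 1≤j′ j′≤a kj′ Hj′<ℓ))

ρ-Φ̃ : ∀ ℓ {{_ : NonZero ℓ}} {L} → IsPartition L → IsCore ℓ L → ρ (ℓ ∸ 1) (Φ̃ ℓ L) ≡ Υ (ρ ℓ L)
ρ-Φ̃ ℓ {L} (pos , lk) core = begin
  rowsFrom g 1 μ                                  ≡⟨ cong (rowsFrom g 1) μ≡ ⟩
  rowsFrom g 1 (dropZeros (map K L))              ≡⟨ rowsFrom-dropZeros 1 K-linked (λ _ → refl) positive ⟩
  dropZeros (rowsFrom g 1 (map K L))              ≡⟨ cong dropZeros (rowsFrom-map g K 1 L) ⟩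
  dropZeros (rowsFrom (λ r a → g r (K a)) 1 L)    ≡⟨ cong dropZeros (rowsFrom-cong 1 L identity) ⟩
  dropZeros (rowsFrom (λ r a → f r a ∸ 1) 1 L)    ≡⟨ cong dropZeros (map-rowsFrom (_∸ 1) f 1 L) ⟨
  dropZeros (map (_∸ 1) (rowsFrom f 1 L))         ∎
  where
  open ≡-Reasoning
  open Compression lk ℓ core
  g f : ℕ → ℕ → ℕ
  g r = countUpTo (λ y → hook μ r y <ᵇ ℓ ∸ 1)
  f r = countUpTo (λ y → hook L r y <ᵇ ℓ)
  row-nonempty : ∀ t → t < length L → 1 ≤ part L (suc t)
  row-nonempty t t<k = part-positive pos (s≤s z≤n) t<k
  identity : ∀ t → t < length L → g (1 + t) (K (part L (suc t))) ≡ f (1 + t) (part L (suc t)) ∸ 1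
  identity t t<k = CompressedRow.row-identity (s≤s z≤n) (row-nonempty t t<k)
  positive : ∀ t → t < length (map K L) → 1 ≤ part (map K L) (suc t) → 1 ≤ g (1 + t) (part (map K L) (suc t))
  positive t t<k = subst (λ n → 1 ≤ n → 1 ≤ g (1 + t) n) (sym (part-map refl L (suc t)))
    (CompressedRow.row-positive (s≤s z≤n) (row-nonempty t (subst (t <_) (length-map K L) t<k)))

-- Deleting the first column

Υ-InB : ∀ {ℓ k} ν → InA ℓ k ν → InB ℓ k (Υ ν)
Υ-InB {ℓ} ν ((_ , lk) , ν₁≤ℓ∸1 , len) =
  (dropZeros-positive (map (_∸ 1) ν) , dropZeros-linked lk∸1) , head-bound ,
  ≤-trans (length-dropZeros (map (_∸ 1) ν)) (≤-reflexive (trans (length-map (_∸ 1) ν) len))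
  where
  lk∸1 : Linked _≥_ (map (_∸ 1) ν)
  lk∸1 = map⁺ (Linked.map (∸-monoˡ-≤ 1) lk)
  head0-∸1 : ∀ ν → head0 (map (_∸ 1) ν) ≡ head0 ν ∸ 1
  head0-∸1 [] = refl
  head0-∸1 (_ ∷ _) = refl
  head-bound : head0 (Υ ν) ≤ ℓ ∸ 2
  head-bound = begin
    head0 (Υ ν)              ≤⟨ head0-dropZeros lk∸1 ⟩
    head0 (map (_∸ 1) ν)     ≡⟨ head0-∸1 ν ⟩
    head0 ν ∸ 1              ≤⟨ ∸-monoˡ-≤ 1 ν₁≤ℓ∸1 ⟩
    ℓ ∸ 1 ∸ 1                ≡⟨ ∸-+-assoc ℓ 1 1 ⟩
    ℓ ∸ 2                    ∎
    where open ≤-Reasoning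

addFirstColumn : ℕ → List ℕ → List ℕ
addFirstColumn m σ = map suc σ ++ replicate m 1

Υ-ones : ∀ m → Υ (replicate m 1) ≡ []
Υ-ones zero = refl
Υ-ones (suc m) = Υ-ones m

Υ-addFirstColumn : ∀ {σ} → All (1 ≤_) σ → ∀ m → Υ (addFirstColumn m σ) ≡ σ
Υ-addFirstColumn [] m = Υ-ones m
Υ-addFirstColumn {suc s ∷ σ} (_ ∷ pos) m = cong (suc s ∷_) (Υ-addFirstColumn pos m)

ones-below-one : ∀ {ν} → Linked _≥_ (1 ∷ ν) → All (1 ≤_) ν → ν ≡ replicate (length ν) 1
ones-below-one {[]} _ _ = refl
ones-below-one {suc zero ∷ ν} (_ ∷ lk) (_ ∷ pos) = cong (1 ∷_) (ones-below-one lk pos)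
ones-below-one {suc (suc _) ∷ _} (s≤s () ∷ _) _

addFirstColumn-Υ : ∀ {ν} → IsPartition ν → addFirstColumn (length ν ∸ length (Υ ν)) (Υ ν) ≡ ν
addFirstColumn-Υ {[]} _ = refl
addFirstColumn-Υ {suc zero ∷ ν} (_ ∷ pos , lk)
  rewrite ones-below-one lk pos | Υ-ones (length ν) | length-replicate (length ν) {1} = refl
addFirstColumn-Υ {suc (suc b) ∷ ν} (_ ∷ pos , lk) = cong (suc (suc b) ∷_) (addFirstColumn-Υ (pos , tail lk))

Υ-injective : ∀ {ℓ k} ν ν′ → InA ℓ k ν → InA ℓ k ν′ → Υ ν ≡ Υ ν′ → ν ≡ ν′
Υ-injective ν ν′ (isPart , _ , len) (isPart′ , _ , len′) Υν≡Υν′ = begin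
  ν                                                  ≡⟨ addFirstColumn-Υ isPart ⟨
  addFirstColumn (length ν ∸ length (Υ ν)) (Υ ν)      ≡⟨ cong₂ (λ n σ → addFirstColumn (n ∸ length σ) σ) (trans len (sym len′)) Υν≡Υν′ ⟩
  addFirstColumn (length ν′ ∸ length (Υ ν′)) (Υ ν′)   ≡⟨ addFirstColumn-Υ isPart′ ⟩
  ν′                                                 ∎
  where open ≡-Reasoning

ones-linked : ∀ m → Linked _≥_ (replicate m 1)
ones-linked zero = []
ones-linked (suc zero) = [-]
ones-linked (suc (suc m)) = ≤-refl ∷ ones-linked (suc m)

addFirstColumn-linked : ∀ {σ} → Linked _≥_ σ → ∀ m → Linked _≥_ (addFirstColumn m σ)
addFirstColumn-linked [] m = ones-linked m
addFirstColumn-linked [-] zero = [-]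
addFirstColumn-linked [-] (suc m) = s≤s z≤n ∷ ones-linked (suc m)
addFirstColumn-linked (s′≤s ∷ lk) m = s≤s s′≤s ∷ addFirstColumn-linked lk m

addFirstColumn-isPartition : ∀ {σ} → IsPartition σ → ∀ m → IsPartition (addFirstColumn m σ)
addFirstColumn-isPartition (pos , lk) m =
  ++⁺ (Allₚ.map⁺ (All.map (λ _ → s≤s z≤n) pos)) (replicate⁺ m ≤-refl) , addFirstColumn-linked lk m

head0-addFirstColumn : ∀ σ m → head0 (addFirstColumn m σ) ≤ suc (head0 σ)
head0-addFirstColumn [] zero = z≤n
head0-addFirstColumn [] (suc m) = ≤-refl
head0-addFirstColumn (_ ∷ _) m = ≤-refl

length-addFirstColumn : ∀ σ m → length (addFirstColumn m σ) ≡ length σ + m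
length-addFirstColumn σ m = begin
  length (map suc σ ++ replicate m 1)          ≡⟨ length-++ (map suc σ) ⟩
  length (map suc σ) + length (replicate m 1)  ≡⟨ cong₂ _+_ (length-map suc σ) (length-replicate m) ⟩
  length σ + m                                 ∎
  where open ≡-Reasoning

Υ-surjective : ∀ {ℓ k} → 2 ≤ ℓ → ∀ σ → InB ℓ k σ → Σ (List ℕ) λ ν → InA ℓ k ν × Υ ν ≡ σ
Υ-surjective {ℓ} {k} 2≤ℓ σ (isPart@(pos , _) , σ₁≤ℓ∸2 , len) =
  addFirstColumn (k ∸ length σ) σ ,
  (addFirstColumn-isPartition isPart (k ∸ length σ) ,
   ≤-trans (head0-addFirstColumn σ _) (≤-trans (s≤s σ₁≤ℓ∸2) (≤-reflexive (sym (+-∸-assoc 1 2≤ℓ)))) ,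
   trans (length-addFirstColumn σ (k ∸ length σ)) (m+[n∸m]≡n len)) ,
  Υ-addFirstColumn pos (k ∸ length σ)

theorem5p3 : (ℓ k : ℕ) → 2 ≤ ℓ → 1 ≤ k →
    ((ν : List ℕ) → InA ℓ k ν → InB ℓ k (Υ ν))
    × ((ν ν′ : List ℕ) → InA ℓ k ν → InA ℓ k ν′ → Υ ν ≡ Υ ν′ → ν ≡ ν′)
    × ((σ : List ℕ) → InB ℓ k σ → Σ (List ℕ) (λ ν → InA ℓ k ν × Υ ν ≡ σ))
    × ((λ′ : List ℕ) → IsPartition λ′ → IsCore ℓ λ′ → length λ′ ≡ k →
        ρ (ℓ ∸ 1) (Φ̃ ℓ λ′) ≡ Υ (ρ ℓ λ′))
theorem5p3 ℓ k 2≤ℓ _ =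
  Υ-InB {ℓ} {k} , Υ-injective {ℓ} {k} , Υ-surjective {ℓ} {k} 2≤ℓ ,
  λ _ isPartition isCore _ → ρ-Φ̃ ℓ isPartition isCore
  where
  instance
    ℓ-nonZero : NonZero ℓ
    ℓ-nonZero = >-nonZero (<-≤-trans z<s 2≤ℓ)
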